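{- Let $G$ be an odd $2$-melon graph consisting of paths $P$ and $P'$ with common endpoints $s$ and $t$. Let $U$ be the vertex set such that $P$ is an $s$-path and $P'$ is a $t$-path with respect to $U$, and let $U'$ be the vertex set such that $P$ is a $t$-path and $P'$ is an $s$-path with respect to $U'$. Then for every edge $e$ of $G$ having exactly one endpoint in $U$ there is a defense of $U$ against the attack on $e$ that shifts $U$ to $U'$; and symmetrically, for every edge $e$ having exactly one endpoint in $U'$ there is a defense of $U'$ against the attack on $e$ that shifts $U'$ to $U$.
   Context: A $2$-melon graph is the union of two internally vertex-disjoint paths with the same two distinct endpoints $s$ and $t$; it is odd if both paths have odd length. For an odd path $P_o$ with vertices $v_0,\dots,v_{2m+1}$ ($m\ge0$), $v_0=t$, $v_{2m+1}=s$, and a vertex set $U$: $P_o$ is an $s$-path w.r.t. $U$ if $(U\cap V(P_o))\setminus\{t\}=\{v_{2i+1}:0\le i\le m\}$, and a $t$-path w.r.t. $U$ if $(U\cap V(P_o))\setminus\{s\}=\{v_{2i}:0\le i\le m\}$. For a vertex cover $U$ of $G=(V,E)$ and an edge $e=zw$ with $z\in U$, $w\notin U$, a defense of $U$ against the attack on $e$ is a one-to-one map $\phi:U\to V$ with $\phi(z)=w$ and $\phi(u)\in N[u]$ (closed neighborhood) for all $u\in U$; $U$ shifts to $\phi(U)$. -}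

module Defs where

open import Data.Nat using (ℕ; suc; _+_; _*_)
open import Data.Fin using (Fin; toℕ; fromℕ; inject₁) renaming (zero to fzero; suc to fsuc)
open import Data.Product using (Σ; ∃; _×_; _,_)
open import Data.Sum using (_⊎_)
open import Relation.Nullary using (¬_)
open import Relation.Binary.PropositionalEquality using (_≡_; _≢_)
open import Function.Bundles using (_⇔_)

IsEven : ℕ → Set
IsEven n = ∃ λ k → n ≡ 2 * k

IsOdd : ℕ → Set
IsOdd n = ∃ λ k → n ≡ 1 + 2 * k

-- An odd path with vertices v_0,…,v_{2m+1} in a vertex type V
-- is given by its vertex sequence  v : Fin (2 + 2 * m) → V.
OddPathSeq : Set → ℕ → Set
OddPathSeq V m = Fin (2 + 2 * m) → V

lastIx : (m : ℕ) → Fin (2 + 2 * m)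
lastIx m = fromℕ (1 + 2 * m)

IsPath : {V : Set} (E : V → V → Set) (m : ℕ) → OddPathSeq V m → Set
IsPath E m p =
  (∀ i j → p i ≡ p j → i ≡ j) ×
  (∀ (i : Fin (1 + 2 * m)) → E (p (inject₁ i)) (p (fsuc i)))

PathEdge : {V : Set} (m : ℕ) → OddPathSeq V m → V → V → Set
PathEdge m p x y = ∃ λ (i : Fin (1 + 2 * m)) →
  ((p (inject₁ i) ≡ x) × (p (fsuc i) ≡ y)) ⊎ ((p (inject₁ i) ≡ y) × (p (fsuc i) ≡ x))

OnPath : {V : Set} (m : ℕ) → OddPathSeq V m → V → Set
OnPath m p x = ∃ λ j → p j ≡ x

IsOddMelon : {V : Set} (E : V → V → Set) (s t : V) (m m' : ℕ) →
             OddPathSeq V m → OddPathSeq V m' → Set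
IsOddMelon E s t m m' P P' =
  (s ≢ t) ×
  (P fzero ≡ t) × (P (lastIx m) ≡ s) ×
  (P' fzero ≡ t) × (P' (lastIx m') ≡ s) ×
  IsPath E m P × IsPath E m' P' ×
  (∀ i j → P i ≡ P' j → (P i ≡ s) ⊎ (P i ≡ t)) ×
  (∀ v → OnPath m P v ⊎ OnPath m' P' v) ×
  (∀ x y → E x y ⇔ (PathEdge m P x y ⊎ PathEdge m' P' x y))

IsSPath : {V : Set} (U : V → Set) (s t : V) (m : ℕ) → OddPathSeq V m → Set
IsSPath U s t m P = ∀ x →
  ((U x × OnPath m P x) × x ≢ t) ⇔ (∃ λ j → IsOdd (toℕ j) × P j ≡ x)

IsTPath : {V : Set} (U : V → Set) (s t : V) (m : ℕ) → OddPathSeq V m → Set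
IsTPath U s t m P = ∀ x →
  ((U x × OnPath m P x) × x ≢ s) ⇔ (∃ λ j → IsEven (toℕ j) × P j ≡ x)

-- φ is a defense of U against the attack on the edge zw (z ∈ U, w ∉ U):
-- φ is one-to-one on U, φ(z) = w, and φ(u) ∈ N[u] for all u ∈ U.
-- (φ is a total function on V; only its restriction to U matters.)
IsDefense : {V : Set} (E : V → V → Set) (U : V → Set) (z w : V) (φ : V → V) → Set
IsDefense E U z w φ =
  (φ z ≡ w) ×
  (∀ u v → U u → U v → φ u ≡ φ v → u ≡ v) ×
  (∀ u → U u → (φ u ≡ u) ⊎ E u (φ u))

ShiftsTo : {V : Set} (U U' : V → Set) (φ : V → V) → Set
ShiftsTo U U' φ = ∀ v → U' v ⇔ (∃ λ u → U u × φ u ≡ v)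

-- Number the vertices of the melon around the cycle t = P₀, P₁, …, P_a = s = P'_b, …, P'₁, i.e.
-- position k ≤ a is P_k and position k > a is P'_(c+1-k); the cycle has even length c + 1 = a + b.
-- In positions, U = {0} ∪ {odd k ≤ a} ∪ {even k > a} and U' = {a} ∪ {even k ≤ a} ∪ {odd k > a}.
-- An edge leaving U is either a backward step k → k - 1, answered by rotating every guard one step
-- backwards, or a forward step k → k + 1 with k ∉ {0, a}, answered by moving every guard one step
-- forwards except those on t = 0 and s = a; both maps carry U onto U'. Exchanging P and P'
-- exchanges U and U', which gives the second half.
module Submission where

open import Defs
open import Data.Nat using (ℕ; zero; suc; _+_; _*_; _∸_; _≤_; _<_; z≤n; s≤s; _≟_; _≤?_; parity)
open import Data.Nat.Properties
open import Data.Parity.Base using (Parity; 0ℙ; 1ℙ; _⁻¹) renaming (_+_ to _+ℙ_)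
open import Data.Parity.Properties as ℙ using (+-homo-+; *-homo-*; p+p≡0ℙ)
open import Data.Fin using (Fin; toℕ; inject₁) renaming (zero to fzero; suc to fsuc)
open import Data.Fin.Properties using (toℕ-inject₁; toℕ-fromℕ; toℕ≤pred[n]; toℕ≤n)
open import Data.Product using (∃; _×_; _,_; proj₁; proj₂)
open import Data.Sum as Sum using (_⊎_; inj₁; inj₂)
open import Function using (_∘_)
open import Function.Bundles using (_⇔_; mk⇔; Equivalence)
open import Function.Properties.Equivalence using () renaming (trans to ⇔-trans)
open import Relation.Nullary using (¬_; yes; no; contradiction)
open import Relation.Binary.PropositionalEquality

open Equivalence using (to; from)

parity-2* : ∀ n → parity (2 * n) ≡ 0ℙ
parity-2* = *-homo-* 2

suc-flips-parity : ∀ n {π} → parity n ≡ π → parity (suc n) ≡ π ⁻¹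
suc-flips-parity n p = trans (+-homo-+ 1 n) (cong _⁻¹ p)

pred-flips-parity : ∀ n {π} → parity (suc n) ≡ π → parity n ≡ π ⁻¹
pred-flips-parity n p = trans (sym (ℙ.suc-homo-⁻¹ n)) (cong _⁻¹ p)

even⇒≢odd : ∀ {k l} → parity k ≡ 0ℙ → parity l ≡ 1ℙ → k ≢ l
even⇒≢odd p q refl with trans (sym p) q
... | ()

parity-∸ : ∀ {m n} → n ≤ m → parity (m ∸ n) ≡ parity m +ℙ parity n
parity-∸ {m} {n} n≤m = begin
  parity (m ∸ n)                           ≡⟨ sym (ℙ.+-identityʳ _) ⟩
  parity (m ∸ n) +ℙ 0ℙ                     ≡⟨ cong (parity (m ∸ n) +ℙ_) (sym (p+p≡0ℙ (parity n))) ⟩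
  parity (m ∸ n) +ℙ (parity n +ℙ parity n) ≡⟨ sym (ℙ.+-assoc (parity (m ∸ n)) _ _) ⟩
  parity (m ∸ n) +ℙ parity n +ℙ parity n   ≡⟨ cong (_+ℙ parity n) (sym (+-homo-+ (m ∸ n) n)) ⟩
  parity (m ∸ n + n) +ℙ parity n           ≡⟨ cong (λ k → parity k +ℙ parity n) (m∸n+n≡m n≤m) ⟩
  parity m +ℙ parity n                     ∎
  where open ≡-Reasoning

IsEven⇔parity≡0ℙ : ∀ {n} → IsEven n ⇔ parity n ≡ 0ℙ
IsEven⇔parity≡0ℙ = mk⇔ (λ { (k , refl) → parity-2* k }) (even _)
  where
  even : ∀ n → parity n ≡ 0ℙ → IsEven n
  even zero          _  = 0 , refl
  even (suc (suc n)) eq with even n eq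
  ... | k , refl = suc k , sym (*-distribˡ-+ 2 1 k)

IsOdd⇔parity≡1ℙ : ∀ {n} → IsOdd n ⇔ parity n ≡ 1ℙ
IsOdd⇔parity≡1ℙ = mk⇔ (λ { (k , refl) → suc-flips-parity (2 * k) (parity-2* k) }) (odd _)
  where
  odd : ∀ n → parity n ≡ 1ℙ → IsOdd n
  odd (suc zero)    _  = 0 , refl
  odd (suc (suc n)) eq with odd n eq
  ... | k , refl = suc k , cong suc (sym (*-distribˡ-+ 2 1 k))

clamp : ∀ n → ℕ → Fin (suc n)
clamp zero    _       = fzero
clamp (suc n) zero    = fzero
clamp (suc n) (suc k) = fsuc (clamp n k)

toℕ-clamp : ∀ {n k} → k ≤ n → toℕ (clamp n k) ≡ k
toℕ-clamp {zero}  z≤n       = refl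
toℕ-clamp {suc n} z≤n       = refl
toℕ-clamp {suc n} (s≤s k≤n) = cong suc (toℕ-clamp k≤n)

clamp-toℕ : ∀ {n} (i : Fin (suc n)) → clamp n (toℕ i) ≡ i
clamp-toℕ {zero}  fzero    = refl
clamp-toℕ {suc n} fzero    = refl
clamp-toℕ {suc n} (fsuc i) = cong fsuc (clamp-toℕ i)

clamp-inject₁ : ∀ {n k} → k ≤ n → clamp (suc n) k ≡ inject₁ (clamp n k)
clamp-inject₁ {zero}  z≤n       = refl
clamp-inject₁ {suc n} z≤n       = refl
clamp-inject₁ {suc n} (s≤s k≤n) = cong fsuc (clamp-inject₁ k≤n)

module OddPath {V : Set} (m : ℕ) (p : OddPathSeq V m) where

  -- Indices beyond 1 + 2 * m are clamped to the last vertex.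
  at : ℕ → V
  at k = p (clamp (1 + 2 * m) k)

  at-toℕ : ∀ i → at (toℕ i) ≡ p i
  at-toℕ i = cong p (clamp-toℕ i)

  at-last : at (1 + 2 * m) ≡ p (lastIx m)
  at-last = trans (cong at (sym (toℕ-fromℕ _))) (at-toℕ (lastIx m))

  edge-sym : ∀ {x y} → PathEdge m p x y → PathEdge m p y x
  edge-sym (i , inj₁ ends) = i , inj₂ ends
  edge-sym (i , inj₂ ends) = i , inj₁ ends

  at-edge : ∀ {k} → k ≤ 2 * m → PathEdge m p (at k) (at (suc k))
  at-edge k≤2m = _ , inj₁ (cong p (sym (clamp-inject₁ k≤2m)) , refl)

  -- IsSPath U s t m p is Marked U t IsOdd, and IsTPath U s t m p is Marked U s IsEven.
  Marked : (V → Set) → V → (ℕ → Set) → Set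
  Marked U y Q = ∀ x → ((U x × OnPath m p x) × x ≢ y) ⇔ (∃ λ j → Q (toℕ j) × p j ≡ x)

  marked⇒∈ : ∀ {U y} (Q : ℕ → Set) → Marked U y Q → ∀ i → Q (toℕ i) → U (p i)
  marked⇒∈ Q marked i q = proj₁ (proj₁ (from (marked (p i)) (i , q , refl)))

  module _ (p-injective : ∀ i j → p i ≡ p j → i ≡ j) where

    at-injective : ∀ {k l} → k ≤ 1 + 2 * m → l ≤ 1 + 2 * m → at k ≡ at l → k ≡ l
    at-injective {k} {l} k≤ l≤ eq = begin
      k                         ≡⟨ sym (toℕ-clamp k≤) ⟩
      toℕ (clamp (1 + 2 * m) k) ≡⟨ cong toℕ (p-injective _ _ eq) ⟩
      toℕ (clamp (1 + 2 * m) l) ≡⟨ toℕ-clamp l≤ ⟩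
      l                         ∎
      where open ≡-Reasoning

    marked⇔ : ∀ {U y} (Q : ℕ → Set) → Marked U y Q →
              ∀ {k} → k ≤ 1 + 2 * m → at k ≢ y → U (at k) ⇔ Q k
    marked⇔ Q marked {k} k≤ k≢y = mk⇔
      (λ u → let j , q , pj≡ = to (marked (at k)) ((u , _ , refl) , k≢y)
             in subst Q (toℕ-clamp k≤) (subst (Q ∘ toℕ) (p-injective _ _ pj≡) q))
      (marked⇒∈ Q marked _ ∘ subst Q (sym (toℕ-clamp k≤)))

    sPath-parity : ∀ {U t} → Marked U t IsOdd →
                   ∀ {k} → k ≤ 1 + 2 * m → at k ≢ t → U (at k) ⇔ parity k ≡ 1ℙ
    sPath-parity sp k≤ k≢t = ⇔-trans (marked⇔ IsOdd sp k≤ k≢t) IsOdd⇔parity≡1ℙ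

    tPath-parity : ∀ {U s} → Marked U s IsEven →
                   ∀ {k} → k ≤ 1 + 2 * m → at k ≢ s → U (at k) ⇔ parity k ≡ 0ℙ
    tPath-parity tp k≤ k≢s = ⇔-trans (marked⇔ IsEven tp k≤ k≢s) IsEven⇔parity≡0ℙ

module Cycle (m m' : ℕ) where

  a c : ℕ
  a = 1 + 2 * m
  c = a + 2 * m'

  parity-a : parity a ≡ 1ℙ
  parity-a = suc-flips-parity (2 * m) (parity-2* m)

  parity-c : parity c ≡ 1ℙ
  parity-c = trans (+-homo-+ a (2 * m')) (cong₂ _+ℙ_ parity-a (parity-2* m'))

  a≤c : a ≤ c
  a≤c = m≤m+n a (2 * m')

  Step : ℕ → ℕ → Set
  Step k l = l ≡ suc k ⊎ (k ≡ c × l ≡ 0)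

  Adjacent : ℕ → ℕ → Set
  Adjacent k l = Step k l ⊎ Step l k

  data Alternating (x₀ : ℕ) (π : Parity) : ℕ → Set where
    base : Alternating x₀ π x₀
    onP  : ∀ {k} → k ≤ a → parity k ≡ π → Alternating x₀ π k
    onP' : ∀ {k} → a < k → parity k ≡ π ⁻¹ → Alternating x₀ π k

  InU InU' : ℕ → Set
  InU  = Alternating 0 1ℙ
  InU' = Alternating a 0ℙ

  InU'-c : InU' c
  InU'-c with m≤n⇒m<n∨m≡n a≤c
  ... | inj₁ a<c = onP' a<c parity-c
  ... | inj₂ a≡c = subst InU' a≡c base

  Alternating-⇔ : ∀ (W : ℕ → Set) {x₀ π} → W x₀ →
                  (∀ {k} → k ≤ a → k ≢ x₀ → W k ⇔ parity k ≡ π) →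
                  (∀ {k} → a < k → k ≤ c → W k ⇔ parity k ≡ π ⁻¹) →
                  ∀ {k} → k ≤ c → W k ⇔ Alternating x₀ π k
  Alternating-⇔ W {x₀} w₀ onP⇔ onP'⇔ {k} k≤c with k ≟ x₀
  ... | yes refl = mk⇔ (λ _ → base) (λ _ → w₀)
  ... | no  k≢x₀ with k ≤? a
  ...   | yes k≤a = mk⇔ (onP k≤a ∘ to (onP⇔ k≤a k≢x₀)) (from (onP⇔ k≤a k≢x₀) ∘ λ
            { base         → contradiction refl k≢x₀
            ; (onP _ π≡)   → π≡
            ; (onP' a<k _) → contradiction k≤a (<⇒≱ a<k) })
  ...   | no  k≰a = mk⇔ (onP' a<k ∘ to (onP'⇔ a<k k≤c)) (from (onP'⇔ a<k k≤c) ∘ λ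
            { base         → contradiction refl k≢x₀
            ; (onP k≤a _)  → contradiction k≤a k≰a
            ; (onP' _ π≡)  → π≡ })
    where
    a<k : a < k
    a<k = ≰⇒> k≰a

  record Shift (h : ℕ → ℕ) : Set where
    field
      bounded        : ∀ {k} → k ≤ c → InU k → h k ≤ c
      injective      : ∀ {k l} → k ≤ c → l ≤ c → InU k → InU l → h k ≡ h l → k ≡ l
      stays-or-steps : ∀ {k} → k ≤ c → InU k → h k ≡ k ⊎ Adjacent k (h k)
      image          : ∀ {k} → k ≤ c → InU k → InU' (h k)
      onto           : ∀ {k} → k ≤ c → InU' k → ∃ λ j → j ≤ c × InU j × h j ≡ k

  rotate : ℕ → ℕ
  rotate zero    = c
  rotate (suc k) = k

  rotate-shift : Shift rotate
  rotate-shift = record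
    { bounded        = λ k≤c _ → bounded k≤c
    ; injective      = λ k≤c l≤c _ _ → injective k≤c l≤c
    ; stays-or-steps = λ {k} _ _ → inj₂ (rotate-adjacent k)
    ; image          = λ _ → image
    ; onto           = onto
    }
    where
    bounded : ∀ {k} → k ≤ c → rotate k ≤ c
    bounded {zero}  _   = ≤-refl
    bounded {suc k} k<c = <⇒≤ k<c

    injective : ∀ {k l} → k ≤ c → l ≤ c → rotate k ≡ rotate l → k ≡ l
    injective {zero}  {zero}  _   _   _  = refl
    injective {zero}  {suc l} _   l<c eq = contradiction (sym eq) (<⇒≢ l<c)
    injective {suc k} {zero}  k<c _   eq = contradiction eq (<⇒≢ k<c)
    injective {suc k} {suc l} _   _   eq = cong suc eq

    rotate-adjacent : ∀ k → Adjacent k (rotate k)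
    rotate-adjacent zero    = inj₂ (inj₂ (refl , refl))
    rotate-adjacent (suc k) = inj₂ (inj₁ refl)

    image : ∀ {k} → InU k → InU' (rotate k)
    image base                      = InU'-c
    image {zero}  (onP _ ())
    image {suc k} (onP k<a odd)     = onP (<⇒≤ k<a) (pred-flips-parity k odd)
    image {suc k} (onP' a<k+1 even) with m≤n⇒m<n∨m≡n (≤-pred a<k+1)
    ... | inj₁ a<k  = onP' a<k (pred-flips-parity k even)
    ... | inj₂ refl = base

    onto : ∀ {k} → k ≤ c → InU' k → ∃ λ j → j ≤ c × InU j × rotate j ≡ k
    onto {k} k≤c k∈U' with k ≟ c
    ... | yes refl = 0 , z≤n , base , refl
    ... | no k≢c   = suc k , ≤∧≢⇒< k≤c k≢c , successor k∈U' , refl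
      where
      successor : ∀ {k} → InU' k → InU (suc k)
      successor base               = onP' ≤-refl (suc-flips-parity a parity-a)
      successor {k} (onP k≤a even) = onP (≤∧≢⇒< k≤a (even⇒≢odd even parity-a)) (suc-flips-parity k even)
      successor {k} (onP' a<k odd) = onP' (m<n⇒m<1+n a<k) (suc-flips-parity k odd)

  slide : ℕ → ℕ
  slide zero    = zero
  slide (suc k) with suc k ≟ a
  ... | yes _ = suc k
  ... | no  _ = suc (suc k)

  slide-a : slide a ≡ a
  slide-a with a ≟ a
  ... | yes _   = refl
  ... | no  a≢a = contradiction refl a≢a

  slide-suc : ∀ {k} → suc k ≢ a → slide (suc k) ≡ suc (suc k)
  slide-suc {k} k+1≢a with suc k ≟ a
  ... | yes k+1≡a = contradiction k+1≡a k+1≢a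
  ... | no  _     = refl

  data SlideCase (k : ℕ) : Set where
    fixed : slide k ≡ k → k ≡ 0 ⊎ k ≡ a → SlideCase k
    moved : slide k ≡ suc k → suc k ≤ c → suc k ≢ a → InU' (suc k) → SlideCase k

  slide-case : ∀ {k} → k ≤ c → InU k → SlideCase k
  slide-case _ base = fixed refl (inj₁ refl)
  slide-case {zero}  _ (onP _ ())
  slide-case {suc k} _ (onP k<a odd) with suc k ≟ a
  ... | yes refl  = fixed slide-a (inj₂ refl)
  ... | no  k+1≢a = moved (slide-suc k+1≢a) (≤-trans k+1<a a≤c) (even⇒≢odd even parity-a) (onP k+1<a even)
    where
    k+1<a : suc k < a
    k+1<a = ≤∧≢⇒< k<a k+1≢a
    even : parity (suc (suc k)) ≡ 0ℙ
    even = suc-flips-parity (suc k) odd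
  slide-case {suc k} k<c (onP' a<k+1 even) =
    moved (slide-suc (≢-sym (<⇒≢ a<k+1))) (≤∧≢⇒< k<c (even⇒≢odd even parity-c))
          (≢-sym (<⇒≢ (m<n⇒m<1+n a<k+1))) (onP' (m<n⇒m<1+n a<k+1) (suc-flips-parity (suc k) even))

  slide-shift : Shift slide
  slide-shift = record
    { bounded        = bounded
    ; injective      = injective
    ; stays-or-steps = stays-or-steps
    ; image          = image
    ; onto           = onto
    }
    where
    bounded : ∀ {k} → k ≤ c → InU k → slide k ≤ c
    bounded k≤c k∈U with slide-case k≤c k∈U
    ... | fixed eq _       = subst (_≤ c) (sym eq) k≤c
    ... | moved eq k<c _ _ = subst (_≤ c) (sym eq) k<c

    fixed≢moved : ∀ {k l} → k ≡ 0 ⊎ k ≡ a → suc l ≢ a → k ≢ suc l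
    fixed≢moved (inj₁ refl) _     ()
    fixed≢moved (inj₂ refl) l+1≢a eq = l+1≢a (sym eq)

    injective : ∀ {k l} → k ≤ c → l ≤ c → InU k → InU l → slide k ≡ slide l → k ≡ l
    injective k≤c l≤c k∈U l∈U eq with slide-case k≤c k∈U | slide-case l≤c l∈U
    ... | fixed ek _       | fixed el _       = trans (sym ek) (trans eq el)
    ... | fixed ek fk      | moved el _ l≢a _ = contradiction (trans (sym ek) (trans eq el)) (fixed≢moved fk l≢a)
    ... | moved ek _ k≢a _ | fixed el fl      = contradiction (trans (sym el) (trans (sym eq) ek)) (fixed≢moved fl k≢a)
    ... | moved ek _ _ _   | moved el _ _ _   = suc-injective (trans (sym ek) (trans eq el))

    stays-or-steps : ∀ {k} → k ≤ c → InU k → slide k ≡ k ⊎ Adjacent k (slide k)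
    stays-or-steps k≤c k∈U with slide-case k≤c k∈U
    ... | fixed eq _     = inj₁ eq
    ... | moved eq _ _ _ = inj₂ (inj₁ (inj₁ eq))

    image : ∀ {k} → k ≤ c → InU k → InU' (slide k)
    image k≤c k∈U with slide-case k≤c k∈U
    ... | fixed eq (inj₁ refl) = onP z≤n refl
    ... | fixed eq (inj₂ refl) = subst InU' (sym eq) base
    ... | moved eq _ _ k+1∈U'  = subst InU' (sym eq) k+1∈U'

    onto : ∀ {k} → k ≤ c → InU' k → ∃ λ j → j ≤ c × InU j × slide j ≡ k
    onto _ base                     = a , a≤c , onP ≤-refl parity-a , slide-a
    onto {zero}     _ (onP _ _)     = 0 , z≤n , base , refl
    onto {suc zero} _ (onP _ ())
    onto {suc (suc j)} _ (onP j+2≤a even) =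
      suc j , ≤-trans (<⇒≤ j+2≤a) a≤c , onP (<⇒≤ j+2≤a) (pred-flips-parity (suc j) even) ,
      slide-suc (<⇒≢ j+2≤a)
    onto {suc zero} _ (onP' (s≤s ()) _)
    onto {suc (suc j)} j+2≤c (onP' a<j+2 odd) =
      suc j , <⇒≤ j+2≤c , onP' a<j+1 even , slide-suc (≢-sym (<⇒≢ a<j+1))
      where
      even : parity (suc j) ≡ 0ℙ
      even = pred-flips-parity (suc j) odd
      a<j+1 : a < suc j
      a<j+1 = ≤∧≢⇒< (≤-pred a<j+2) (≢-sym (even⇒≢odd even parity-a))

  attack : ∀ {k l} → Adjacent k l → InU k → ¬ InU l → l ≡ rotate k ⊎ l ≡ slide k
  attack {zero}  (inj₁ (inj₁ refl))        _ l∉U = contradiction (onP (s≤s z≤n) refl) l∉U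
  attack {suc k} (inj₁ (inj₁ refl))        _ l∉U with suc k ≟ a
  ... | yes refl = contradiction (onP' ≤-refl (suc-flips-parity a parity-a)) l∉U
  ... | no  _    = inj₂ refl
  attack         (inj₁ (inj₂ (_ , refl)))    _ l∉U = contradiction base l∉U
  attack         (inj₂ (inj₁ refl))          _ _   = inj₁ refl
  attack         (inj₂ (inj₂ (refl , refl))) _ _   = inj₁ refl

module Melon {V : Set} {E : V → V → Set} {s t : V} (m m' : ℕ)
  {P : OddPathSeq V m} {P' : OddPathSeq V m'}
  (P-t : P fzero ≡ t) (P-s : P (lastIx m) ≡ s) (P'-t : P' fzero ≡ t) (P'-s : P' (lastIx m') ≡ s)
  (P-injective : ∀ i j → P i ≡ P j → i ≡ j) (P'-injective : ∀ i j → P' i ≡ P' j → i ≡ j)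
  (P-P'-meet : ∀ i j → P i ≡ P' j → P i ≡ s ⊎ P i ≡ t)
  (cover : ∀ v → OnPath m P v ⊎ OnPath m' P' v)
  (edges : ∀ x y → E x y ⇔ (PathEdge m P x y ⊎ PathEdge m' P' x y))
  where

  open Cycle m m'
  module PathP  = OddPath m P
  module PathP' = OddPath m' P'

  b : ℕ
  b = 1 + 2 * m'

  [c+1]∸a≡b : suc c ∸ a ≡ b
  [c+1]∸a≡b = trans (+-∸-assoc 1 a≤c) (cong suc (m+n∸m≡n a (2 * m')))

  [c+1]∸b≡a : suc c ∸ b ≡ a
  [c+1]∸b≡a = m+n∸n≡m a (2 * m')

  P-at-a : PathP.at a ≡ s
  P-at-a = trans PathP.at-last P-s

  P'-at-b : PathP'.at b ≡ s
  P'-at-b = trans PathP'.at-last P'-s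

  vertex : ℕ → V
  vertex k with k ≤? a
  ... | yes _ = PathP.at k
  ... | no  _ = PathP'.at (suc c ∸ k)

  vertex-P : ∀ {k} → k ≤ a → vertex k ≡ PathP.at k
  vertex-P {k} k≤a with k ≤? a
  ... | yes _   = refl
  ... | no  k≰a = contradiction k≤a k≰a

  vertex-P' : ∀ {k} → a ≤ k → vertex k ≡ PathP'.at (suc c ∸ k)
  vertex-P' {k} a≤k with k ≤? a
  ... | no  _   = refl
  ... | yes k≤a with ≤-antisym k≤a a≤k
  ...   | refl = begin
    PathP.at a             ≡⟨ P-at-a ⟩
    s                      ≡⟨ sym P'-at-b ⟩
    PathP'.at b            ≡⟨ cong PathP'.at (sym [c+1]∸a≡b) ⟩
    PathP'.at (suc c ∸ a)  ∎
    where open ≡-Reasoning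

  P'-index-≤ : ∀ {k} → a ≤ k → suc c ∸ k ≤ b
  P'-index-≤ {k} a≤k = subst (suc c ∸ k ≤_) [c+1]∸a≡b (∸-monoʳ-≤ (suc c) a≤k)

  vertex-Pᵢ : ∀ i → vertex (toℕ i) ≡ P i
  vertex-Pᵢ i = trans (vertex-P (toℕ≤pred[n] i)) (PathP.at-toℕ i)

  vertex-P'ⱼ : ∀ j → vertex (suc c ∸ toℕ j) ≡ P' j
  vertex-P'ⱼ j = begin
    vertex (suc c ∸ toℕ j)                ≡⟨ vertex-P' a≤index ⟩
    PathP'.at (suc c ∸ (suc c ∸ toℕ j))   ≡⟨ cong PathP'.at (m∸[m∸n]≡n j≤c+1) ⟩
    PathP'.at (toℕ j)                     ≡⟨ PathP'.at-toℕ j ⟩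
    P' j                                  ∎
    where
    open ≡-Reasoning
    j≤b : toℕ j ≤ b
    j≤b = toℕ≤pred[n] j
    j≤c+1 : toℕ j ≤ suc c
    j≤c+1 = ≤-trans j≤b (s≤s (m≤n+m (2 * m') a))
    a≤index : a ≤ suc c ∸ toℕ j
    a≤index = subst (_≤ suc c ∸ toℕ j) [c+1]∸b≡a (∸-monoʳ-≤ (suc c) j≤b)

  vertex-0 : vertex 0 ≡ t
  vertex-0 = trans (vertex-P z≤n) P-t

  vertex-a : vertex a ≡ s
  vertex-a = trans (vertex-P ≤-refl) P-at-a

  vertex-[c+1] : vertex (suc c) ≡ t
  vertex-[c+1] = trans (vertex-P'ⱼ fzero) P'-t

  P'-side-≢s : ∀ {l} → a < l → l ≤ c → vertex l ≢ s
  P'-side-≢s {l} a<l l≤c vl≡s = <⇒≢ a<l (sym l≡a)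
    where
    index≡b : suc c ∸ l ≡ b
    index≡b = PathP'.at-injective P'-injective (P'-index-≤ (<⇒≤ a<l)) ≤-refl
                (trans (sym (vertex-P' (<⇒≤ a<l))) (trans vl≡s (sym P'-at-b)))
    l≡a : l ≡ a
    l≡a = ∸-cancelˡ-≡ (m≤n⇒m≤1+n l≤c) (m≤n⇒m≤1+n a≤c) (trans index≡b (sym [c+1]∸a≡b))

  P'-side-≢t : ∀ {l} → a < l → l ≤ c → vertex l ≢ t
  P'-side-≢t {l} a<l l≤c vl≡t = 1+n≰n (≤-trans (m∸n≡0⇒m≤n index≡0) l≤c)
    where
    index≡0 : suc c ∸ l ≡ 0
    index≡0 = PathP'.at-injective P'-injective (P'-index-≤ (<⇒≤ a<l)) z≤n
                (trans (sym (vertex-P' (<⇒≤ a<l))) (trans vl≡t (sym P'-t)))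

  P-P'-apart : ∀ {k l} → k ≤ a → a < l → l ≤ c → vertex k ≢ vertex l
  P-P'-apart k≤a a<l l≤c eq with P-P'-meet _ _ (trans (sym (vertex-P k≤a)) (trans eq (vertex-P' (<⇒≤ a<l))))
  ... | inj₁ k≡s = P'-side-≢s a<l l≤c (trans (sym eq) (trans (vertex-P k≤a) k≡s))
  ... | inj₂ k≡t = P'-side-≢t a<l l≤c (trans (sym eq) (trans (vertex-P k≤a) k≡t))

  vertex-injective : ∀ {k l} → k ≤ c → l ≤ c → vertex k ≡ vertex l → k ≡ l
  vertex-injective {k} {l} k≤c l≤c eq with ≤-<-connex k a | ≤-<-connex l a
  ... | inj₁ k≤a | inj₁ l≤a =
    PathP.at-injective P-injective k≤a l≤a (trans (sym (vertex-P k≤a)) (trans eq (vertex-P l≤a)))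
  ... | inj₂ a<k | inj₂ a<l = ∸-cancelˡ-≡ (m≤n⇒m≤1+n k≤c) (m≤n⇒m≤1+n l≤c)
    (PathP'.at-injective P'-injective (P'-index-≤ (<⇒≤ a<k)) (P'-index-≤ (<⇒≤ a<l))
      (trans (sym (vertex-P' (<⇒≤ a<k))) (trans eq (vertex-P' (<⇒≤ a<l)))))
  ... | inj₁ k≤a | inj₂ a<l = contradiction eq (P-P'-apart k≤a a<l l≤c)
  ... | inj₂ a<k | inj₁ l≤a = contradiction (sym eq) (P-P'-apart l≤a a<k k≤c)

  vertex-surjective : ∀ v → ∃ λ k → k ≤ c × vertex k ≡ v
  vertex-surjective v with cover v
  ... | inj₁ (i , refl)      = toℕ i , ≤-trans (toℕ≤pred[n] i) a≤c , vertex-Pᵢ i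
  ... | inj₂ (fzero , refl)  = 0 , z≤n , trans vertex-0 (sym P'-t)
  ... | inj₂ (fsuc j , refl) = c ∸ toℕ j , m∸n≤m c (toℕ j) , vertex-P'ⱼ (fsuc j)

  position : V → ℕ
  position v = proj₁ (vertex-surjective v)

  position-≤ : ∀ v → position v ≤ c
  position-≤ v = proj₁ (proj₂ (vertex-surjective v))

  vertex-position : ∀ v → vertex (position v) ≡ v
  vertex-position v = proj₂ (proj₂ (vertex-surjective v))

  position-vertex : ∀ {k} → k ≤ c → position (vertex k) ≡ k
  position-vertex k≤c = vertex-injective (position-≤ _) k≤c (vertex-position _)

  vertex≢t : ∀ {k} → k ≤ c → k ≢ 0 → vertex k ≢ t
  vertex≢t k≤c k≢0 vk≡t = k≢0 (vertex-injective k≤c z≤n (trans vk≡t (sym vertex-0)))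

  vertex≢s : ∀ {k} → k ≤ c → k ≢ a → vertex k ≢ s
  vertex≢s k≤c k≢a vk≡s = k≢a (vertex-injective k≤c a≤c (trans vk≡s (sym vertex-a)))

  E-sym : ∀ {x y} → E x y → E y x
  E-sym {x} {y} e = from (edges y x) (Sum.map PathP.edge-sym PathP'.edge-sym (to (edges x y) e))

  edge-suc : ∀ {k} → k ≤ c → E (vertex k) (vertex (suc k))
  edge-suc {k} k≤c with ≤-<-connex a k
  ... | inj₂ k<a = from (edges _ _) (inj₁ (subst₂ (PathEdge m P)
          (sym (vertex-P (<⇒≤ k<a))) (sym (vertex-P k<a)) (PathP.at-edge (≤-pred k<a))))
  ... | inj₁ a≤k = E-sym (from (edges _ _) (inj₂ (subst₂ (PathEdge m' P')
          (sym (vertex-P' (m≤n⇒m≤1+n a≤k))) (sym (trans (vertex-P' a≤k) (cong PathP'.at (+-∸-assoc 1 k≤c))))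
          (PathP'.at-edge c∸k≤2m'))))
    where
    c∸k≤2m' : c ∸ k ≤ 2 * m'
    c∸k≤2m' = subst (c ∸ k ≤_) (m+n∸m≡n a (2 * m')) (∸-monoʳ-≤ c a≤k)

  step-edge : ∀ {k l} → k ≤ c → Step k l → E (vertex k) (vertex l)
  step-edge k≤c (inj₁ refl)          = edge-suc k≤c
  step-edge k≤c (inj₂ (refl , refl)) = subst (E (vertex c)) (trans vertex-[c+1] (sym vertex-0)) (edge-suc k≤c)

  adjacent-edge : ∀ {k l} → k ≤ c → l ≤ c → Adjacent k l → E (vertex k) (vertex l)
  adjacent-edge k≤c _   (inj₁ step) = step-edge k≤c step
  adjacent-edge _   l≤c (inj₂ step) = E-sym (step-edge l≤c step)

  record Located (z w : V) : Set where
    constructor located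
    field
      {k l}    : ℕ
      k≤c      : k ≤ c
      l≤c      : l ≤ c
      vertex-k : vertex k ≡ z
      vertex-l : vertex l ≡ w
      adjacent : Adjacent k l

  Located-sym : ∀ {z w} → Located z w → Located w z
  Located-sym (located k≤c l≤c vk vl adj) = located l≤c k≤c vl vk (Sum.swap adj)

  successive-located : ∀ {k} → k ≤ c → Located (vertex k) (vertex (suc k))
  successive-located {k} k≤c with k ≟ c
  ... | yes refl = located k≤c z≤n refl (trans vertex-0 (sym vertex-[c+1])) (inj₁ (inj₂ (refl , refl)))
  ... | no  k≢c  = located k≤c (≤∧≢⇒< k≤c k≢c) refl refl (inj₁ (inj₁ refl))

  P-edge-located : ∀ i → Located (P (inject₁ i)) (P (fsuc i))
  P-edge-located i =
    subst₂ Located (trans (cong vertex (sym (toℕ-inject₁ i))) (vertex-Pᵢ (inject₁ i))) (vertex-Pᵢ (fsuc i))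
      (successive-located (≤-trans (toℕ≤n i) a≤c))

  P'-edge-located : ∀ j → Located (P' (fsuc j)) (P' (inject₁ j))
  P'-edge-located j = subst₂ Located (vertex-P'ⱼ (fsuc j)) (begin
      vertex (suc (c ∸ toℕ j))          ≡⟨ cong vertex (sym (+-∸-assoc 1 j≤c)) ⟩
      vertex (suc c ∸ toℕ j)            ≡⟨ cong (λ x → vertex (suc c ∸ x)) (sym (toℕ-inject₁ j)) ⟩
      vertex (suc c ∸ toℕ (inject₁ j))  ≡⟨ vertex-P'ⱼ (inject₁ j) ⟩
      P' (inject₁ j)                    ∎)
    (successive-located (m∸n≤m c (toℕ j)))
    where
    open ≡-Reasoning
    j≤c : toℕ j ≤ c
    j≤c = ≤-trans (toℕ≤pred[n] j) (m≤n+m (2 * m') a)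

  edge-located : ∀ {z w} → E z w → Located z w
  edge-located {z} {w} e with to (edges z w) e
  ... | inj₁ (i , inj₁ (refl , refl)) = P-edge-located i
  ... | inj₁ (i , inj₂ (refl , refl)) = Located-sym (P-edge-located i)
  ... | inj₂ (j , inj₁ (refl , refl)) = Located-sym (P'-edge-located j)
  ... | inj₂ (j , inj₂ (refl , refl)) = P'-edge-located j

  on-P : ∀ (W : V → Set) {y π} →
         (∀ {k} → k ≤ a → PathP.at k ≢ y → W (PathP.at k) ⇔ parity k ≡ π) →
         ∀ {k} → k ≤ a → vertex k ≢ y → W (vertex k) ⇔ parity k ≡ π
  on-P W {π = π} along-P {k} k≤a k≢y = subst (λ x → W x ⇔ parity k ≡ π) (sym (vertex-P k≤a))
    (along-P k≤a (k≢y ∘ trans (vertex-P k≤a)))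

  on-P' : ∀ (W : V → Set) {y π} →
          (∀ {j} → j ≤ b → PathP'.at j ≢ y → W (PathP'.at j) ⇔ parity j ≡ π) →
          ∀ {k} → a < k → k ≤ c → vertex k ≢ y → W (vertex k) ⇔ parity k ≡ π
  on-P' W {π = π} along-P' {k} a<k k≤c k≢y =
    subst₂ (λ x q → W x ⇔ q ≡ π) (sym (vertex-P' (<⇒≤ a<k))) parity-index
      (along-P' (P'-index-≤ (<⇒≤ a<k)) (k≢y ∘ trans (vertex-P' (<⇒≤ a<k))))
    where
    parity-index : parity (suc c ∸ k) ≡ parity k
    parity-index = trans (parity-∸ (m≤n⇒m≤1+n k≤c)) (cong (_+ℙ parity k) (suc-flips-parity c parity-c))

  module Defense (U U' : V → Set)
    (U-P : IsSPath U s t m P) (U-P' : IsTPath U s t m' P')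
    (U'-P : IsTPath U' s t m P) (U'-P' : IsSPath U' s t m' P') where

    ∈U⇔ : ∀ {k} → k ≤ c → U (vertex k) ⇔ InU k
    ∈U⇔ = Alternating-⇔ (U ∘ vertex) U-vertex-0 along-P along-P'
      where
      U-vertex-0 : U (vertex 0)
      U-vertex-0 = subst U (trans P'-t (sym vertex-0)) (PathP'.marked⇒∈ IsEven U-P' fzero (0 , refl))

      along-P : ∀ {k} → k ≤ a → k ≢ 0 → U (vertex k) ⇔ parity k ≡ 1ℙ
      along-P k≤a k≢0 = on-P U (PathP.sPath-parity P-injective U-P) k≤a (vertex≢t (≤-trans k≤a a≤c) k≢0)

      along-P' : ∀ {k} → a < k → k ≤ c → U (vertex k) ⇔ parity k ≡ 0ℙ
      along-P' a<k k≤c = on-P' U (PathP'.tPath-parity P'-injective U-P') a<k k≤c (vertex≢s k≤c (≢-sym (<⇒≢ a<k)))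

    ∈U'⇔ : ∀ {k} → k ≤ c → U' (vertex k) ⇔ InU' k
    ∈U'⇔ = Alternating-⇔ (U' ∘ vertex) U'-vertex-a along-P along-P'
      where
      U'-vertex-a : U' (vertex a)
      U'-vertex-a = subst U' (trans P'-s (sym vertex-a)) (PathP'.marked⇒∈ IsOdd U'-P' (lastIx m') (m' , toℕ-fromℕ _))

      along-P : ∀ {k} → k ≤ a → k ≢ a → U' (vertex k) ⇔ parity k ≡ 0ℙ
      along-P k≤a k≢a = on-P U' (PathP.tPath-parity P-injective U'-P) k≤a (vertex≢s (≤-trans k≤a a≤c) k≢a)

      along-P' : ∀ {k} → a < k → k ≤ c → U' (vertex k) ⇔ parity k ≡ 1ℙ
      along-P' a<k k≤c = on-P' U' (PathP'.sPath-parity P'-injective U'-P') a<k k≤c (vertex≢t k≤c (m<n⇒n≢0 a<k))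

    induced : (ℕ → ℕ) → V → V
    induced h v = vertex (h (position v))

    position-∈U : ∀ {u} → U u → InU (position u)
    position-∈U {u} Uu = to (∈U⇔ (position-≤ u)) (subst U (sym (vertex-position u)) Uu)

    module _ {h : ℕ → ℕ} (shift : Shift h) where
      open Shift shift

      induced-≤ : ∀ {u} → U u → h (position u) ≤ c
      induced-≤ {u} Uu = bounded (position-≤ u) (position-∈U Uu)

      induced-injective : ∀ u v → U u → U v → induced h u ≡ induced h v → u ≡ v
      induced-injective u v Uu Uv eq = begin
        u                    ≡⟨ sym (vertex-position u) ⟩
        vertex (position u)  ≡⟨ cong vertex position-eq ⟩
        vertex (position v)  ≡⟨ vertex-position v ⟩
        v                    ∎
        where
        open ≡-Reasoning
        position-eq : position u ≡ position v
        position-eq = injective (position-≤ u) (position-≤ v) (position-∈U Uu) (position-∈U Uv)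
                        (vertex-injective (induced-≤ Uu) (induced-≤ Uv) eq)

      induced-stays-or-steps : ∀ u → U u → induced h u ≡ u ⊎ E u (induced h u)
      induced-stays-or-steps u Uu with stays-or-steps (position-≤ u) (position-∈U Uu)
      ... | inj₁ h-fixes = inj₁ (trans (cong vertex h-fixes) (vertex-position u))
      ... | inj₂ adj     = inj₂ (subst (λ x → E x (induced h u)) (vertex-position u)
                                 (adjacent-edge (position-≤ u) (induced-≤ Uu) adj))

      induced-defense : ∀ {k l} → k ≤ c → h k ≡ l → IsDefense E U (vertex k) (vertex l) (induced h)
      induced-defense k≤c hk≡l =
        trans (cong (vertex ∘ h) (position-vertex k≤c)) (cong vertex hk≡l) , induced-injective , induced-stays-or-steps

      induced-shifts : ShiftsTo U U' (induced h)
      induced-shifts v = mk⇔ preimage image-in-U'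
        where
        image-in-U' : (∃ λ u → U u × induced h u ≡ v) → U' v
        image-in-U' (u , Uu , refl) = from (∈U'⇔ (induced-≤ Uu)) (image (position-≤ u) (position-∈U Uu))

        preimage : U' v → ∃ λ u → U u × induced h u ≡ v
        preimage U'v with onto (position-≤ v) (to (∈U'⇔ (position-≤ v)) (subst U' (sym (vertex-position v)) U'v))
        ... | j , j≤c , j∈U , hj≡ = vertex j , from (∈U⇔ j≤c) j∈U , (begin
          vertex (h (position (vertex j)))  ≡⟨ cong (vertex ∘ h) (position-vertex j≤c) ⟩
          vertex (h j)                      ≡⟨ cong vertex hj≡ ⟩
          vertex (position v)               ≡⟨ vertex-position v ⟩
          v                                 ∎)
          where open ≡-Reasoning

    defend : ∀ {z w} → E z w → U z → ¬ U w → ∃ λ φ → IsDefense E U z w φ × ShiftsTo U U' φ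
    defend e Uz ¬Uw with edge-located e
    ... | located k≤c l≤c refl refl adj with attack adj (to (∈U⇔ k≤c) Uz) (¬Uw ∘ from (∈U⇔ l≤c))
    ...   | inj₁ l≡rotate =
      induced rotate , induced-defense rotate-shift k≤c (sym l≡rotate) , induced-shifts rotate-shift
    ...   | inj₂ l≡slide  =
      induced slide , induced-defense slide-shift k≤c (sym l≡slide) , induced-shifts slide-shift

IsOddMelon-swap : ∀ {V : Set} {E : V → V → Set} {s t : V} (m m' : ℕ)
                  {P : OddPathSeq V m} {P' : OddPathSeq V m'} →
                  IsOddMelon E s t m m' P P' → IsOddMelon E s t m' m P' P
IsOddMelon-swap _ _ (s≢t , P-t , P-s , P'-t , P'-s , P-path , P'-path , meet , cover , edges) =
  s≢t , P'-t , P'-s , P-t , P-s , P'-path , P-path ,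
  (λ j i eq → Sum.map (trans eq) (trans eq) (meet i j (sym eq))) ,
  Sum.swap ∘ cover ,
  λ x y → mk⇔ (Sum.swap ∘ to (edges x y)) (from (edges x y) ∘ Sum.swap)

melon-defense : ∀ {V : Set} {E : V → V → Set} {s t : V} (m m' : ℕ)
                {P : OddPathSeq V m} {P' : OddPathSeq V m'} →
                IsOddMelon E s t m m' P P' → (U U' : V → Set) →
                IsSPath U s t m P → IsTPath U s t m' P' →
                IsTPath U' s t m P → IsSPath U' s t m' P' →
                ∀ z w → E z w → U z → ¬ U w →
                ∃ λ φ → IsDefense E U z w φ × ShiftsTo U U' φ
melon-defense m m' (_ , P-t , P-s , P'-t , P'-s , (P-injective , _) , (P'-injective , _) , meet , cover , edges)
              U U' U-P U-P' U'-P U'-P' _ _ =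
  Melon.Defense.defend m m' P-t P-s P'-t P'-s P-injective P'-injective meet cover edges U U' U-P U-P' U'-P U'-P'

lemma12 : {V : Set} (E : V → V → Set) (s t : V) (m m' : ℕ)
          (P : OddPathSeq V m) (P' : OddPathSeq V m') →
          IsOddMelon E s t m m' P P' →
          (U U' : V → Set) →
          IsSPath U s t m P → IsTPath U s t m' P' →
          IsTPath U' s t m P → IsSPath U' s t m' P' →
          ((∀ z w → E z w → U z → ¬ U w →
             ∃ λ φ → IsDefense E U z w φ × ShiftsTo U U' φ) ×
           (∀ z w → E z w → U' z → ¬ U' w →
             ∃ λ φ → IsDefense E U' z w φ × ShiftsTo U' U φ))
lemma12 E s t m m' P P' melon U U' U-P U-P' U'-P U'-P' =
  melon-defense m m' melon U U' U-P U-P' U'-P U'-P' ,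
  melon-defense m' m (IsOddMelon-swap m m' melon) U' U U'-P' U'-P U-P' U-P
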